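{- Let $\lambda,\mu$ be partitions and $n\in\mathbb{N}$ with $\ell(\lambda),\ell(\mu)\le n$. Let $k\in[0,n]$ be such that $k=0$ or $\mu_k\ge\lambda_{k+1}$. Define the partitions $\lambda^{\le k}=(\lambda_1,\ldots,\lambda_k)$, $\lambda^{>k}=(\lambda_{k+1},\ldots,\lambda_n)$, $\mu^{\le k}=(\mu_1,\ldots,\mu_k)$, $\mu^{>k}=(\mu_{k+1},\ldots,\mu_n)$. Then \[s_{\lambda/\mu}=s_{\lambda^{\le k}/\mu^{\le k}}\cdot\varphi^{ -k}\left(s_{\lambda^{>k}/\mu^{>k}}\right).\]
   Context: $R$ is the polynomial ring over $\mathbb{Z}$ in indeterminates $h_{r,s}$ ($r\ge1$, $s\in\mathbb{Z}$); set $h_{0,s}=1$ and $h_{r,s}=0$ for $r<0$. $\varphi$ is the ring automorphism of $R$ with $\varphi(h_{r,s})=h_{r,s+1}$, and $h_r:=h_{r,0}$, so $\varphi^sh_r=h_{r,s}$. For partitions $\lambda,\mu$ (not necessarily nested) and any $n$ with $\ell(\lambda),\ell(\mu)\le n$, $s_{\lambda/\mu}=\det\left(\varphi^{\mu_j-j+1}h_{\lambda_i-\mu_j-i+j}\right)_{1\le i,j\le n}$ (independent of $n$; for $n=0$ it is $1$). $\ell$ denotes length; $[0,n]=\{0,\ldots,n\}$. -}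

module Defs where

open import Level using (Level)
open import Data.Nat using (ℕ; zero; suc; _≥_; _<_; _⊔_)
open import Data.Integer using (ℤ; +_; -[1+_]; +[1+_]) renaming (_+_ to _+ℤ_; _-_ to _-ℤ_)
open import Data.Fin using (Fin; zero; suc; toℕ; punchIn)
open import Data.List using (List; []; _∷_; length; take; drop)
open import Data.List.Relation.Unary.All using (All; []; _∷_)
open import Data.List.Relation.Unary.Linked using (Linked; []; [-]; _∷_)
open import Algebra.Bundles using (CommutativeRing)

record Partition : Set where
  constructor mkPartition
  field
    parts : List ℕ
    decr  : Linked _≥_ parts
    pos   : All (λ x → 0 < x) parts
open Partition public

ℓ : Partition → ℕ
ℓ p = length (parts p)

-- 0-indexed part lookup with default 0: p ! i = λ_{i+1}
lookup0 : List ℕ → ℕ → ℕ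
lookup0 []       _       = 0
lookup0 (x ∷ xs) zero    = x
lookup0 (x ∷ xs) (suc i) = lookup0 xs i

_!_ : Partition → ℕ → ℕ
p ! i = lookup0 (parts p) i

private
  linked-take : ∀ {xs : List ℕ} k → Linked _≥_ xs → Linked _≥_ (take k xs)
  linked-take zero    _          = []
  linked-take (suc k) []         = []
  linked-take (suc zero) [-]     = [-]
  linked-take (suc (suc k)) [-]  = [-]
  linked-take {x ∷ y ∷ ys} (suc zero) (r ∷ l) = [-]
  linked-take {x ∷ y ∷ ys} (suc (suc k)) (r ∷ l) with linked-take (suc k) l
  ... | l' = r ∷ l'

  linked-drop : ∀ {xs : List ℕ} k → Linked _≥_ xs → Linked _≥_ (drop k xs)
  linked-drop zero    l        = l
  linked-drop (suc k) []       = []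
  linked-drop (suc k) [-]      = linked-drop k []
  linked-drop (suc k) (r ∷ l)  = linked-drop k l

  all-take : ∀ {P : ℕ → Set} {xs : List ℕ} k → All P xs → All P (take k xs)
  all-take zero    _        = []
  all-take (suc k) []       = []
  all-take (suc k) (p ∷ ps) = p ∷ all-take k ps

  all-drop : ∀ {P : ℕ → Set} {xs : List ℕ} k → All P xs → All P (drop k xs)
  all-drop zero    ps       = ps
  all-drop (suc k) []       = []
  all-drop (suc k) (p ∷ ps) = all-drop k ps

upTo : ℕ → Partition → Partition
upTo k p = mkPartition (take k (parts p)) (linked-take k (decr p)) (all-take k (pos p))

-- λ^{>k} = (λ_{k+1},…) (equals (λ_{k+1},…,λ_n) when ℓ(λ) ≤ n)
above : ℕ → Partition → Partition
above k p = mkPartition (drop k (parts p)) (linked-drop k (decr p)) (all-drop k (pos p))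

module Schur {c ℓ' : Level} (R : CommutativeRing c ℓ') where
  open CommutativeRing R using (Carrier; _+_; _*_; -_; 0#; 1#)

  sumF : (n : ℕ) → (Fin n → Carrier) → Carrier
  sumF zero    f = 0#
  sumF (suc n) f = f zero + sumF n (λ j → f (suc j))

  sign : ℕ → Carrier
  sign zero    = 1#
  sign (suc m) = - sign m

  det : (n : ℕ) → (Fin n → Fin n → Carrier) → Carrier
  det zero    M = 1#
  det (suc n) M =
    sumF (suc n) (λ j → sign (toℕ j) * (M zero j * det n (λ a b → M (suc a) (punchIn j b))))

  -- An assignment H of the generators: H r s is the value of h_{r,s} (only r ≥ 1 is used).
  -- hval H r s = value of h_{r,s} with h_{0,s} = 1 and h_{r,s} = 0 for r < 0.
  hval : (ℕ → ℤ → Carrier) → ℤ → ℤ → Carrier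
  hval H (+ zero)    s = 1#
  hval H +[1+ r ]    s = H (suc r) s
  hval H -[1+ r ]    s = 0#

  -- the value of φ^m(p) at H equals the value of p at (shift m H)
  shift : ℤ → (ℕ → ℤ → Carrier) → (ℕ → ℤ → Carrier)
  shift m H r s = H r (s +ℤ m)

  -- s_{λ/μ} evaluated at H, as an n×n determinant (n chosen as max(ℓ λ, ℓ μ)).
  -- Entry (i,j) (1-indexed) is φ^{μ_j - j + 1} h_{λ_i - μ_j - i + j} = h_{λ_i-μ_j-i+j, μ_j-j+1}.
  skewDet : (ℕ → ℤ → Carrier) → Partition → Partition → (n : ℕ) → Carrier
  skewDet H la mu n = det n (λ i j →
    hval H ((((+ (la ! toℕ i)) -ℤ (+ (mu ! toℕ j))) -ℤ (+ toℕ i)) +ℤ (+ toℕ j))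
           ((+ (mu ! toℕ j)) -ℤ (+ toℕ j)))

  skew : (ℕ → ℤ → Carrier) → Partition → Partition → Carrier
  skew H la mu = skewDet H la mu (ℓ la ⊔ ℓ mu)

-- The Jacobi–Trudi matrix of λ/μ has its (i, j) entry of degree λ_i − μ_j − i + j, so it vanishes
-- whenever λ_i + j < μ_j + i. For i > k ≥ j the hypothesis μ_k ≥ λ_{k+1} gives λ_i ≤ λ_{k+1} ≤ μ_k ≤ μ_j
-- and j < i, so the lower-left (n−k)×k block is zero and the determinant is the product of the two
-- diagonal blocks. The upper one is the matrix of λ^{≤k}/μ^{≤k}; the lower one is that of λ^{>k}/μ^{>k}
-- with all second indices lowered by k, i.e. φ^{-k} applied to it.
module Submission where

open import Defs
open import Level using (Level)
open import Data.Nat using (ℕ; _≤_; _∸_)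
open import Data.Integer using (ℤ; +_) renaming (-_ to -ℤ_)
open import Data.Sum using (_⊎_)
open import Relation.Binary.PropositionalEquality using (_≡_)
open import Algebra.Bundles using (CommutativeRing)

open import Data.Nat using (zero; suc; z≤n; s≤s; _<_; _≤′_; ≤′-refl; ≤′-step)
import Data.Nat as N
import Data.Nat.Properties as NP
import Data.Integer as Z
import Data.Integer.Properties as ZP
open import Data.Integer.Solver using (module +-*-Solver)
open import Data.Fin using (Fin; toℕ; punchIn; _↑ˡ_; _↑ʳ_)
import Data.Fin.Properties as FP
open import Data.List using (List; []; _∷_; length; take; drop)
open import Data.List.Relation.Unary.Linked using (Linked; []; [-]; _∷_)
import Data.List.Properties as LP
open import Data.Sum using (inj₁; inj₂)
open import Relation.Binary.PropositionalEquality as Eq using (cong; cong₂; subst)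
open import Relation.Nullary using (yes; no)

toℕ-punchIn-< : ∀ {n} (j : Fin (suc n)) (c : Fin n) → toℕ c < toℕ j → toℕ (punchIn j c) ≡ toℕ c
toℕ-punchIn-< (Fin.suc j) Fin.zero    _       = Eq.refl
toℕ-punchIn-< (Fin.suc j) (Fin.suc c) (s≤s p) = cong suc (toℕ-punchIn-< j c p)

toℕ-punchIn-≤ : ∀ {n} (j : Fin (suc n)) (c : Fin n) → toℕ (punchIn j c) ≤ suc (toℕ c)
toℕ-punchIn-≤ Fin.zero    c           = NP.≤-refl
toℕ-punchIn-≤ (Fin.suc j) Fin.zero    = z≤n
toℕ-punchIn-≤ (Fin.suc j) (Fin.suc c) = s≤s (toℕ-punchIn-≤ j c)

punchIn-↑ˡ : ∀ {a} b (j : Fin (suc a)) (c : Fin a) → punchIn (j ↑ˡ b) (c ↑ˡ b) ≡ punchIn j c ↑ˡ b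
punchIn-↑ˡ b Fin.zero    c           = Eq.refl
punchIn-↑ˡ b (Fin.suc j) Fin.zero    = Eq.refl
punchIn-↑ˡ b (Fin.suc j) (Fin.suc c) = cong Fin.suc (punchIn-↑ˡ b j c)

punchIn-↑ˡ-↑ʳ : ∀ {b} a (j : Fin (suc a)) (c : Fin b) → punchIn (j ↑ˡ b) (a ↑ʳ c) ≡ Fin.suc (a ↑ʳ c)
punchIn-↑ˡ-↑ʳ zero    Fin.zero    c = Eq.refl
punchIn-↑ˡ-↑ʳ (suc a) Fin.zero    c = Eq.refl
punchIn-↑ˡ-↑ʳ (suc a) (Fin.suc j) c = cong Fin.suc (punchIn-↑ˡ-↑ʳ a j c)

lookup0-beyond : ∀ xs i → length xs ≤ i → lookup0 xs i ≡ 0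
lookup0-beyond []       i       _       = Eq.refl
lookup0-beyond (x ∷ xs) (suc i) (s≤s p) = lookup0-beyond xs i p

lookup0-take : ∀ k xs i → i < k → lookup0 (take k xs) i ≡ lookup0 xs i
lookup0-take (suc k) []       i       _       = Eq.refl
lookup0-take (suc k) (x ∷ xs) zero    _       = Eq.refl
lookup0-take (suc k) (x ∷ xs) (suc i) (s≤s p) = lookup0-take k xs i p

lookup0-drop : ∀ k xs i → lookup0 (drop k xs) i ≡ lookup0 xs (k N.+ i)
lookup0-drop zero    xs       i = Eq.refl
lookup0-drop (suc k) []       i = Eq.refl
lookup0-drop (suc k) (x ∷ xs) i = lookup0-drop k xs i

lookup0-suc-≤ : ∀ {xs} → Linked N._≥_ xs → ∀ i → lookup0 xs (suc i) ≤ lookup0 xs i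
lookup0-suc-≤ []      i       = z≤n
lookup0-suc-≤ [-]     i       = z≤n
lookup0-suc-≤ (r ∷ l) zero    = r
lookup0-suc-≤ (r ∷ l) (suc i) = lookup0-suc-≤ l i

lookup0-antitone : ∀ {xs} → Linked N._≥_ xs → ∀ {i j} → i ≤′ j → lookup0 xs j ≤ lookup0 xs i
lookup0-antitone l ≤′-refl        = NP.≤-refl
lookup0-antitone l (≤′-step i≤′j) = NP.≤-trans (lookup0-suc-≤ l _) (lookup0-antitone l i≤′j)

module DeterminantProperties {c l : Level} (R : CommutativeRing c l) where
  open CommutativeRing R
  open Schur R
  open import Relation.Binary.Reasoning.Setoid setoid

  sumF-cong : ∀ n {f g : Fin n → Carrier} → (∀ j → f j ≈ g j) → sumF n f ≈ sumF n g
  sumF-cong zero    p = refl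
  sumF-cong (suc n) p = +-cong (p Fin.zero) (sumF-cong n (λ j → p (Fin.suc j)))

  sumF-zero : ∀ n {f : Fin n → Carrier} → (∀ j → f j ≈ 0#) → sumF n f ≈ 0#
  sumF-zero zero    p = refl
  sumF-zero (suc n) p = trans (+-cong (p Fin.zero) (sumF-zero n (λ j → p (Fin.suc j)))) (+-identityˡ 0#)

  sumF-+ : ∀ a b (f : Fin (a N.+ b) → Carrier) →
    sumF (a N.+ b) f ≈ sumF a (λ j → f (j ↑ˡ b)) + sumF b (λ j → f (a ↑ʳ j))
  sumF-+ zero    b f = sym (+-identityˡ _)
  sumF-+ (suc a) b f = trans (+-cong refl (sumF-+ a b (λ j → f (Fin.suc j)))) (sym (+-assoc _ _ _))

  sumF-*ʳ : ∀ n (f : Fin n → Carrier) x → sumF n f * x ≈ sumF n (λ j → f j * x)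
  sumF-*ʳ zero    f x = zeroˡ x
  sumF-*ʳ (suc n) f x = trans (distribʳ x _ _) (+-cong refl (sumF-*ʳ n _ x))

  minor : ∀ {n} → Fin (suc n) → (Fin (suc n) → Fin (suc n) → Carrier) → Fin n → Fin n → Carrier
  minor j M x y = M (Fin.suc x) (punchIn j y)

  -- det (suc n) M is definitionally sumF (suc n) (cofactorTerm n M).
  cofactorTerm : ∀ n → (Fin (suc n) → Fin (suc n) → Carrier) → Fin (suc n) → Carrier
  cofactorTerm n M j = sign (toℕ j) * (M Fin.zero j * det n (minor j M))

  cofactorTerm-zeroᵉ : ∀ n M j → M Fin.zero j ≈ 0# → cofactorTerm n M j ≈ 0#
  cofactorTerm-zeroᵉ n M j p = trans (*-cong refl (trans (*-cong p refl) (zeroˡ _))) (zeroʳ _)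

  cofactorTerm-zeroᵐ : ∀ n M j → det n (minor j M) ≈ 0# → cofactorTerm n M j ≈ 0#
  cofactorTerm-zeroᵐ n M j p = trans (*-cong refl (trans (*-cong refl p) (zeroʳ _))) (zeroʳ _)

  det-cong : ∀ n {M M' : Fin n → Fin n → Carrier} → (∀ i j → M i j ≈ M' i j) → det n M ≈ det n M'
  det-cong zero    p = refl
  det-cong (suc n) {M} {M'} p = sumF-cong (suc n) {cofactorTerm n M} {cofactorTerm n M'} (λ j →
    *-cong refl (*-cong (p Fin.zero j) (det-cong n (λ x y → p (Fin.suc x) (punchIn j y)))))

  det₁ : ∀ (M : Fin 1 → Fin 1 → Carrier) → det 1 M ≈ M Fin.zero Fin.zero
  det₁ M = trans (+-identityʳ _) (trans (*-identityˡ _) (*-identityʳ _))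

  -- Rows ≥ a and columns < b form an (n − a) × b zero block; as (n − a) + b > n, every term of the
  -- expansion meets it.
  det-zeroBlock : ∀ n a b (M : Fin n → Fin n → Carrier) → a < b → b ≤ n →
    (∀ i j → a ≤ toℕ i → toℕ j < b → M i j ≈ 0#) → det n M ≈ 0#
  det-zeroBlock zero    a       zero    M ()       _       _
  det-zeroBlock zero    a       (suc b) M _        ()      _
  det-zeroBlock (suc n) (suc a) zero    M ()       _       _
  det-zeroBlock (suc n) zero    b       M a<b      b≤n     zero-block = sumF-zero (suc n) term
    where
    term : ∀ j → cofactorTerm n M j ≈ 0#
    term j with toℕ j N.<? b
    ... | yes j<b = cofactorTerm-zeroᵉ n M j (zero-block Fin.zero j z≤n j<b)
    ... | no  j≮b = cofactorTerm-zeroᵐ n M j (det-zeroBlock n 0 b _ a<b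
            (NP.≤-trans b≤j (NP.≤-pred (FP.toℕ<n j)))
            (λ x y _ y<b → zero-block (Fin.suc x) (punchIn j y) z≤n
               (subst (_< b) (Eq.sym (toℕ-punchIn-< j y (NP.<-≤-trans y<b b≤j))) y<b)))
      where b≤j = NP.≮⇒≥ j≮b
  det-zeroBlock (suc n) (suc a) (suc b) M (s≤s a<b) (s≤s b≤n) zero-block = sumF-zero (suc n) (λ j →
    cofactorTerm-zeroᵐ n M j (det-zeroBlock n a b _ a<b b≤n (λ x y a≤x y<b →
      zero-block (Fin.suc x) (punchIn j y) (s≤s a≤x) (NP.≤-<-trans (toℕ-punchIn-≤ j y) (s≤s y<b)))))

  det-blockTriangular : ∀ a b (M : Fin (a N.+ b) → Fin (a N.+ b) → Carrier) →
    (∀ i j → a ≤ toℕ i → toℕ j < a → M i j ≈ 0#) →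
    det (a N.+ b) M ≈ det a (λ i j → M (i ↑ˡ b) (j ↑ˡ b)) * det b (λ i j → M (a ↑ʳ i) (a ↑ʳ j))
  det-blockTriangular zero    b M zero-block = sym (*-identityˡ _)
  det-blockTriangular (suc a) b M zero-block = begin
    sumF (suc a N.+ b) (cofactorTerm (a N.+ b) M)
      ≈⟨ sumF-+ (suc a) b (cofactorTerm (a N.+ b) M) ⟩
    sumF (suc a) (λ j → cofactorTerm (a N.+ b) M (j ↑ˡ b)) + sumF b (λ j → cofactorTerm (a N.+ b) M (suc a ↑ʳ j))
      ≈⟨ +-cong (sumF-cong (suc a) left) (sumF-zero b right) ⟩
    sumF (suc a) (λ j → cofactorTerm a A j * det b D) + 0#
      ≈⟨ +-identityʳ _ ⟩
    sumF (suc a) (λ j → cofactorTerm a A j * det b D)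
      ≈⟨ sym (sumF-*ʳ (suc a) (cofactorTerm a A) (det b D)) ⟩
    det (suc a) A * det b D ∎
    where
    A : Fin (suc a) → Fin (suc a) → Carrier
    A i j = M (i ↑ˡ b) (j ↑ˡ b)
    D : Fin b → Fin b → Carrier
    D i j = M (suc a ↑ʳ i) (suc a ↑ʳ j)

    -- Deleting a column from the right block leaves a zero block of width suc a in the minor.
    right : ∀ j → cofactorTerm (a N.+ b) M (suc a ↑ʳ j) ≈ 0#
    right j = cofactorTerm-zeroᵐ (a N.+ b) M (suc a ↑ʳ j)
      (det-zeroBlock (a N.+ b) a (suc a) _ NP.≤-refl suc-a≤a+b (λ x y a≤x y<suc-a →
        zero-block (Fin.suc x) (punchIn (suc a ↑ʳ j) y) (s≤s a≤x)
          (subst (_< suc a) (Eq.sym (toℕ-punchIn-< (suc a ↑ʳ j) y (NP.<-≤-trans y<suc-a a<j))) y<suc-a)))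
      where
      a<j : suc a ≤ toℕ (suc a ↑ʳ j)
      a<j = NP.≤-trans (NP.m≤m+n (suc a) (toℕ j)) (NP.≤-reflexive (Eq.sym (FP.toℕ-↑ʳ (suc a) j)))
      suc-a≤a+b : suc a ≤ a N.+ b
      suc-a≤a+b = NP.≤-pred (NP.≤-trans (s≤s a<j) (FP.toℕ<n (suc a ↑ʳ j)))

    left : ∀ j → cofactorTerm (a N.+ b) M (j ↑ˡ b) ≈ cofactorTerm a A j * det b D
    left j = begin
      sign (toℕ (j ↑ˡ b)) * (A Fin.zero j * det (a N.+ b) (minor (j ↑ˡ b) M))
        ≈⟨ *-cong (reflexive (cong sign (FP.toℕ-↑ˡ j b))) (*-cong refl
             (det-blockTriangular a b (minor (j ↑ˡ b) M) (λ x y a≤x y<a →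
               zero-block (Fin.suc x) _ (s≤s a≤x) (NP.≤-<-trans (toℕ-punchIn-≤ (j ↑ˡ b) y) (s≤s y<a))))) ⟩
      sign (toℕ j) * (A Fin.zero j * (det a (λ x y → minor (j ↑ˡ b) M (x ↑ˡ b) (y ↑ˡ b))
                                      * det b (λ x y → minor (j ↑ˡ b) M (a ↑ʳ x) (a ↑ʳ y))))
        ≈⟨ *-cong refl (*-cong refl (*-cong
             (det-cong a (λ x y → reflexive (cong (M (Fin.suc (x ↑ˡ b))) (punchIn-↑ˡ b j y))))
             (det-cong b (λ x y → reflexive (cong (M (Fin.suc (a ↑ʳ x))) (punchIn-↑ˡ-↑ʳ a j y)))))) ⟩
      sign (toℕ j) * (A Fin.zero j * (det a (minor j A) * det b D))
        ≈⟨ sym (trans (*-assoc _ _ _) (*-cong refl (*-assoc _ _ _))) ⟩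
      cofactorTerm a A j * det b D ∎

degree : ℕ → ℕ → ℕ → ℕ → ℤ
degree x y i j = ((+ x Z.- + y) Z.- + i) Z.+ + j

degree-negative : ∀ x y i j → x N.+ j < y N.+ i → degree x y i j ≡ Z.- (+ ((y N.+ i) ∸ (x N.+ j)))
degree-negative x y i j x+j<y+i = begin
  ((+ x Z.- + y) Z.- + i) Z.+ + j   ≡⟨ rearrange (+ x) (+ y) (+ i) (+ j) ⟩
  (+ x Z.+ + j) Z.- (+ y Z.+ + i)   ≡⟨ cong₂ Z._-_ (Eq.sym (ZP.pos-+ x j)) (Eq.sym (ZP.pos-+ y i)) ⟩
  + (x N.+ j) Z.- + (y N.+ i)       ≡⟨ ZP.m-n≡m⊖n (x N.+ j) (y N.+ i) ⟩
  (x N.+ j) Z.⊖ (y N.+ i)           ≡⟨ ZP.⊖-< x+j<y+i ⟩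
  Z.- (+ ((y N.+ i) ∸ (x N.+ j)))   ∎
  where
  open Eq.≡-Reasoning
  open +-*-Solver
  rearrange : ∀ a b i j → ((a Z.- b) Z.- i) Z.+ j ≡ (a Z.+ j) Z.- (b Z.+ i)
  rearrange = solve 4 (λ a b i j → ((a :- b) :- i) :+ j := (a :+ j) :- (b :+ i)) Eq.refl

degree-diagonal : ∀ i → degree 0 0 i i ≡ + 0
degree-diagonal i = Eq.trans (cong (Z._+ + i) (ZP.+-identityˡ (-ℤ (+ i)))) (ZP.+-inverseˡ (+ i))

degree-+ : ∀ x y k i j → degree x y (k N.+ i) (k N.+ j) ≡ degree x y i j
degree-+ x y k i j = begin
  ((+ x Z.- + y) Z.- + (k N.+ i)) Z.+ + (k N.+ j)   ≡⟨ cong₂ (λ u v → ((+ x Z.- + y) Z.- u) Z.+ v) (ZP.pos-+ k i) (ZP.pos-+ k j) ⟩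
  ((+ x Z.- + y) Z.- (+ k Z.+ + i)) Z.+ (+ k Z.+ + j) ≡⟨ cancel (+ x) (+ y) (+ k) (+ i) (+ j) ⟩
  ((+ x Z.- + y) Z.- + i) Z.+ + j ∎
  where
  open Eq.≡-Reasoning
  open +-*-Solver
  cancel : ∀ a b k i j → ((a Z.- b) Z.- (k Z.+ i)) Z.+ (k Z.+ j) ≡ ((a Z.- b) Z.- i) Z.+ j
  cancel = solve 5 (λ a b k i j → ((a :- b) :- (k :+ i)) :+ (k :+ j) := ((a :- b) :- i) :+ j) Eq.refl

shiftIndex-+ : ∀ y k j → (+ y Z.- + j) Z.+ -ℤ (+ k) ≡ + y Z.- + (k N.+ j)
shiftIndex-+ y k j = Eq.trans (rearrange (+ y) (+ k) (+ j)) (cong (λ u → + y Z.- u) (Eq.sym (ZP.pos-+ k j)))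
  where
  open +-*-Solver
  rearrange : ∀ y k j → (y Z.- j) Z.+ (Z.- k) ≡ y Z.- (k Z.+ j)
  rearrange = solve 3 (λ y k j → (y :- j) :+ (:- k) := y :- (k :+ j)) Eq.refl

module JacobiTrudi {c l : Level} (R : CommutativeRing c l) where
  open CommutativeRing R
  open Schur R
  open DeterminantProperties R
  open import Relation.Binary.Reasoning.Setoid setoid

  entry : (ℕ → ℤ → Carrier) → List ℕ → List ℕ → ℕ → ℕ → Carrier
  entry H xs ys i j = hval H (degree (lookup0 xs i) (lookup0 ys j) i j) (+ lookup0 ys j Z.- + j)

  jtDet : (ℕ → ℤ → Carrier) → List ℕ → List ℕ → ℕ → Carrier
  jtDet H xs ys n = det n (λ i j → entry H xs ys (toℕ i) (toℕ j))

  entry-negative : ∀ H xs ys i j → lookup0 xs i N.+ j < lookup0 ys j N.+ i → entry H xs ys i j ≈ 0#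
  entry-negative H xs ys i j lt = reflexive (Eq.trans
    (cong (λ d → hval H d (+ lookup0 ys j Z.- + j)) (degree-negative _ _ i j lt))
    (hval-negative (NP.m<n⇒0<n∸m lt)))
    where
    hval-negative : ∀ {d s} → 0 < d → hval H (Z.- (+ d)) s ≡ 0#
    hval-negative {suc d} _ = Eq.refl

  entry-diagonal : ∀ H xs ys i → lookup0 xs i ≡ 0 → lookup0 ys i ≡ 0 → entry H xs ys i i ≈ 1#
  entry-diagonal H xs ys i xᵢ≡0 yᵢ≡0 rewrite xᵢ≡0 | yᵢ≡0 =
    reflexive (cong (λ d → hval H d (+ 0 Z.- + i)) (degree-diagonal i))

  entry-take : ∀ H xs ys k i j → i < k → j < k → entry H (take k xs) (take k ys) i j ≡ entry H xs ys i j
  entry-take H xs ys k i j i<k j<k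
    rewrite lookup0-take k xs i i<k | lookup0-take k ys j j<k = Eq.refl

  hval-shift : ∀ H m r s → hval (shift m H) r s ≡ hval H r (s Z.+ m)
  hval-shift H m (+ zero)   s = Eq.refl
  hval-shift H m Z.+[1+ r ] s = Eq.refl
  hval-shift H m Z.-[1+ r ] s = Eq.refl

  entry-drop : ∀ H xs ys k i j →
    entry (shift (-ℤ (+ k)) H) (drop k xs) (drop k ys) i j ≡ entry H xs ys (k N.+ i) (k N.+ j)
  entry-drop H xs ys k i j rewrite lookup0-drop k xs i | lookup0-drop k ys j =
    Eq.trans (hval-shift H (-ℤ (+ k)) (degree (lookup0 xs (k N.+ i)) (lookup0 ys (k N.+ j)) i j)
      (+ lookup0 ys (k N.+ j) Z.- + j)) (cong₂ (hval H)
      (Eq.sym (degree-+ (lookup0 xs (k N.+ i)) (lookup0 ys (k N.+ j)) k i j))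
      (shiftIndex-+ (lookup0 ys (k N.+ j)) k j))

  jtDet-upperBlock : ∀ H xs ys k d →
    det k (λ i j → entry H xs ys (toℕ (i ↑ˡ d)) (toℕ (j ↑ˡ d))) ≈ jtDet H (take k xs) (take k ys) k
  jtDet-upperBlock H xs ys k d = det-cong k (λ i j → reflexive (Eq.trans
    (cong₂ (entry H xs ys) (FP.toℕ-↑ˡ i d) (FP.toℕ-↑ˡ j d))
    (Eq.sym (entry-take H xs ys k (toℕ i) (toℕ j) (FP.toℕ<n i) (FP.toℕ<n j)))))

  jtDet-lowerBlock : ∀ H xs ys k d →
    det d (λ i j → entry H xs ys (toℕ (k ↑ʳ i)) (toℕ (k ↑ʳ j)))
      ≈ jtDet (shift (-ℤ (+ k)) H) (drop k xs) (drop k ys) d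
  jtDet-lowerBlock H xs ys k d = det-cong d (λ i j → reflexive (Eq.trans
    (cong₂ (entry H xs ys) (FP.toℕ-↑ʳ k i) (FP.toℕ-↑ʳ k j))
    (Eq.sym (entry-drop H xs ys k (toℕ i) (toℕ j)))))

  jtDet-suc : ∀ H xs ys m → length xs ≤ m → length ys ≤ m → jtDet H xs ys (suc m) ≈ jtDet H xs ys m
  jtDet-suc H xs ys m xs≤m ys≤m = begin
    jtDet H xs ys (suc m)
      ≡⟨ cong (jtDet H xs ys) (NP.+-comm 1 m) ⟩
    jtDet H xs ys (m N.+ 1)
      ≈⟨ det-blockTriangular m 1 _ (λ i j m≤i j<m → entry-negative H xs ys (toℕ i) (toℕ j)
           (subst (λ x → x N.+ toℕ j < lookup0 ys (toℕ j) N.+ toℕ i)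
              (Eq.sym (lookup0-beyond xs (toℕ i) (NP.≤-trans xs≤m m≤i)))
              (NP.<-≤-trans j<m (NP.≤-trans m≤i (NP.m≤n+m (toℕ i) _))))) ⟩
    det m (λ i j → entry H xs ys (toℕ (i ↑ˡ 1)) (toℕ (j ↑ˡ 1)))
      * det 1 corner
      ≈⟨ *-cong (det-cong m (λ i j → reflexive (cong₂ (entry H xs ys) (FP.toℕ-↑ˡ i 1) (FP.toℕ-↑ˡ j 1))))
                (trans (det₁ corner) (entry-diagonal H xs ys (toℕ last)
                  (lookup0-beyond xs _ (NP.≤-trans xs≤m m≤last))
                  (lookup0-beyond ys _ (NP.≤-trans ys≤m m≤last)))) ⟩
    jtDet H xs ys m * 1#
      ≈⟨ *-identityʳ _ ⟩
    jtDet H xs ys m ∎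
    where
    corner : Fin 1 → Fin 1 → Carrier
    corner i j = entry H xs ys (toℕ (m ↑ʳ i)) (toℕ (m ↑ʳ j))
    last : Fin (m N.+ 1)
    last = m ↑ʳ Fin.zero
    m≤last : m ≤ toℕ last
    m≤last = NP.≤-trans (NP.m≤m+n m 0) (NP.≤-reflexive (Eq.sym (FP.toℕ-↑ʳ m Fin.zero)))

  jtDet-stable : ∀ H xs ys {m n} → length xs ≤ m → length ys ≤ m → m ≤′ n →
    jtDet H xs ys n ≈ jtDet H xs ys m
  jtDet-stable H xs ys xs≤m ys≤m ≤′-refl          = refl
  jtDet-stable H xs ys xs≤m ys≤m (≤′-step m≤′n) = trans
    (jtDet-suc H xs ys _ (NP.≤-trans xs≤m (NP.≤′⇒≤ m≤′n)) (NP.≤-trans ys≤m (NP.≤′⇒≤ m≤′n)))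
    (jtDet-stable H xs ys xs≤m ys≤m m≤′n)

  skew-jtDet : ∀ H la mu n → ℓ la ≤ n → ℓ mu ≤ n → skew H la mu ≈ jtDet H (parts la) (parts mu) n
  skew-jtDet H la mu n la≤n mu≤n =
    sym (jtDet-stable H (parts la) (parts mu) (NP.m≤m⊔n _ _) (NP.m≤n⊔m _ _) (NP.≤⇒≤′ (NP.⊔-lub la≤n mu≤n)))

  entry-lowerLeft : ∀ H la mu {k i j} → (k ≡ 0 ⊎ la ! k ≤ mu ! (k ∸ 1)) → k ≤ i → j < k →
    entry H (parts la) (parts mu) i j ≈ 0#
  entry-lowerLeft H la mu (inj₁ Eq.refl) k≤i ()
  entry-lowerLeft H la mu {k} {i} {j} (inj₂ λₖ₊₁≤μₖ) k≤i j<k =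
    entry-negative H (parts la) (parts mu) i j (NP.+-mono-≤-< λᵢ≤μⱼ (NP.<-≤-trans j<k k≤i))
    where
    λᵢ≤μⱼ : la ! i ≤ mu ! j
    λᵢ≤μⱼ = NP.≤-trans (lookup0-antitone (decr la) (NP.≤⇒≤′ k≤i))
              (NP.≤-trans λₖ₊₁≤μₖ (lookup0-antitone (decr mu) (NP.≤⇒≤′ (NP.<⇒≤pred j<k))))

mainTheorem12 : ∀ {c l : Level} (R : CommutativeRing c l)
    (H : ℕ → ℤ → CommutativeRing.Carrier R)
    (la mu : Partition) (n k : ℕ) →
    ℓ la ≤ n → ℓ mu ≤ n → k ≤ n →
    (k ≡ 0 ⊎ la ! k ≤ mu ! (k ∸ 1)) →
    CommutativeRing._≈_ R
      (Schur.skew R H la mu)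
      (CommutativeRing._*_ R
        (Schur.skew R H (upTo k la) (upTo k mu))
        (Schur.skew R (Schur.shift R (-ℤ (+ k)) H) (above k la) (above k mu)))
mainTheorem12 R H la mu n k la≤n mu≤n k≤n split = begin
  skew H la mu
    ≈⟨ skew-jtDet H la mu n la≤n mu≤n ⟩
  jtDet H xs ys n
    ≡⟨ cong (jtDet H xs ys) (Eq.sym (NP.m+[n∸m]≡n k≤n)) ⟩
  jtDet H xs ys (k N.+ d)
    ≈⟨ det-blockTriangular k d _ (λ i j k≤i j<k → entry-lowerLeft H la mu split k≤i j<k) ⟩
  det k (λ i j → entry H xs ys (toℕ (i ↑ˡ d)) (toℕ (j ↑ˡ d)))
    * det d (λ i j → entry H xs ys (toℕ (k ↑ʳ i)) (toℕ (k ↑ʳ j)))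
    ≈⟨ *-cong (jtDet-upperBlock H xs ys k d) (jtDet-lowerBlock H xs ys k d) ⟩
  jtDet H (take k xs) (take k ys) k * jtDet (shift (-ℤ (+ k)) H) (drop k xs) (drop k ys) d
    ≈⟨ sym (*-cong (skew-jtDet H (upTo k la) (upTo k mu) k (take≤ xs) (take≤ ys))
                   (skew-jtDet (shift (-ℤ (+ k)) H) (above k la) (above k mu) d (drop≤ la≤n) (drop≤ mu≤n))) ⟩
  skew H (upTo k la) (upTo k mu) * skew (shift (-ℤ (+ k)) H) (above k la) (above k mu) ∎
  where
  open CommutativeRing R
  open Schur R
  open DeterminantProperties R
  open JacobiTrudi R
  open import Relation.Binary.Reasoning.Setoid setoid
  xs = parts la
  ys = parts mu
  d = n ∸ k
  take≤ : ∀ zs → length (take k zs) ≤ k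
  take≤ zs = NP.≤-trans (NP.≤-reflexive (LP.length-take k zs)) (NP.m⊓n≤m k _)
  drop≤ : ∀ {zs} → length zs ≤ n → length (drop k zs) ≤ d
  drop≤ {zs} zs≤n = NP.≤-trans (NP.≤-reflexive (LP.length-drop k zs)) (NP.∸-monoˡ-≤ k zs≤n)
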